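{- Let $G_1$ and $G_2$ be vertex-disjoint simple connected graphs with vertex sets $\{u_1,\dots,u_n\}$ and $\{v_1,\dots,v_m\}$ labelled so that $d_{G_1}(u_1)\le d_{G_1}(u_2)\le\dots\le d_{G_1}(u_n)$ and $d_{G_2}(v_1)\le d_{G_2}(v_2)\le\dots\le d_{G_2}(v_m)$. Suppose $d_{G_1}(u_i)=d_{G_2}(v_j)$ for some $i,j$ and $d_{G_1}(u_k)=d_{G_2}(v_l)$ for some $k,l$. Let $G'=G_1\rightsquigarrow_{u_iv_l}G_2$ and $G''=G_1\rightsquigarrow_{u_kv_j}G_2$. Then $irr_t(G')=irr_t(G'')$.
   Context: For a simple graph $H$, the total irregularity is $irr_t(H)=\frac12\sum_{x,y\in V(H)}|d_H(x)-d_H(y)|$, where $d_H$ denotes degree in $H$. The edge-joint $G\rightsquigarrow_{uv}H$ of two vertex-disjoint graphs $G,H$ with $u\in V(G)$, $v\in V(H)$ is the graph $G\cup H+uv$ obtained by adding the single edge $uv$. -}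

module Defs where

open import Data.Nat using (ℕ; _+_; _/_; ∣_-_∣; _≤_)
open import Data.Bool using (Bool; true; false; if_then_else_; _∧_)
open import Data.Fin using (Fin; splitAt; toℕ; _≟_)
open import Data.Sum using (inj₁; inj₂)
open import Data.List using (List; map; allFin; concatMap)
open import Data.Nat.ListAction using (sum)
open import Relation.Nullary.Decidable using (⌊_⌋)
open import Relation.Binary.PropositionalEquality using (_≡_)

Adj : ℕ → Set
Adj n = Fin n → Fin n → Bool

record Graph (n : ℕ) : Set where
  field
    adj    : Adj n
    sym    : ∀ x y → adj x y ≡ adj y x
    irrefl : ∀ x → adj x x ≡ false
open Graph public

data Reachable {n : ℕ} (a : Adj n) : Fin n → Fin n → Set where
  here : ∀ {x} → Reachable a x x
  step : ∀ {x y z} → a x y ≡ true → Reachable a y z → Reachable a x z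

Connected : ∀ {n} → Graph n → Set
Connected {n} G = ∀ (x y : Fin n) → Reachable (adj G) x y

deg : ∀ {n} → Adj n → Fin n → ℕ
deg {n} a x = sum (map (λ y → if a x y then 1 else 0) (allFin n))

-- total irregularity: (1/2) Σ_{x,y} |d(x) - d(y)| over ordered pairs (the sum is even)
irrt : ∀ {n} → Adj n → ℕ
irrt {n} a = sum (concatMap (λ x → map (λ y → ∣ deg a x - deg a y ∣) (allFin n)) (allFin n)) / 2

-- edge-joint G ⇝_{uv} H on vertex set Fin (n + m): first n vertices are G's, last m are H's
edgeJoint : ∀ {n m} → Graph n → Graph m → Fin n → Fin m → Adj (n + m)
edgeJoint {n} {m} G H u v x y with splitAt n x | splitAt n y
... | inj₁ a | inj₁ b = adj G a b
... | inj₂ a | inj₂ b = adj H a b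
... | inj₁ a | inj₂ b = ⌊ a ≟ u ⌋ ∧ ⌊ b ≟ v ⌋
... | inj₂ a | inj₁ b = ⌊ b ≟ u ⌋ ∧ ⌊ a ≟ v ⌋

DegSorted : ∀ {n} → Graph n → Set
DegSorted {n} G = ∀ (x y : Fin n) → toℕ x ≤ toℕ y → deg (adj G) x ≤ deg (adj G) y

module Submission where

-- The total irregularity of a graph only depends on its degree sequence up to
-- reordering: irr_t = (1/2) Σₓ Σ_y |d x - d y|, and this double sum is invariant
-- under permutations of the vertices.  Adding the edge u v to the disjoint union
-- of G and H raises exactly the degrees of u and v by one, so the degree sequence
-- of G ⇝_{uv} H is the concatenated sequence d = d_G ++ d_H "bumped" at u and v.
-- The core combinatorial fact (exchange-bumps) is that bumping a sequence f at
-- two distinct places p, q gives the same multiset of values as bumping it at two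
-- distinct places r, s whenever f p = f s and f q = f r; it follows from the
-- observation (bump-swap) that bumping at a or at b is the same up to the
-- transposition of a and b when f a = f b.  The corollary is then immediate with
-- p = uᵢ, q = vₗ, r = uₖ, s = vⱼ.

open import Defs hiding (sym)
open import Data.Nat using (ℕ; zero; suc; _+_; _/_; ∣_-_∣)
open import Data.Nat.Properties using (+-0-commutativeMonoid; +-commutativeSemigroup; +-assoc; +-identityʳ)
open import Data.Bool using (Bool; true; false; if_then_else_; _∧_)
open import Data.Bool.Properties using (∧-comm)
open import Data.Fin using (Fin; zero; suc; _↑ˡ_; _↑ʳ_; _≟_)
open import Data.Fin.Properties using (splitAt-↑ˡ; splitAt-↑ʳ; ↑ˡ-injective; ↑ʳ-injective; suc-injective)
open import Data.Fin.Permutation as Perm using (Permutation; _⟨$⟩ʳ_; _⟨$⟩ˡ_)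
import Data.Fin.Permutation.Components as PC
open import Data.List using (List; map; allFin; tabulate; concat)
open import Data.List.Properties using (map-tabulate)
open import Data.Nat.ListAction using (sum)
open import Data.Nat.ListAction.Properties using (sum-++)
open import Data.Vec.Functional using (_++_)
open import Data.Vec.Functional.Properties using (lookup-++ˡ; lookup-++ʳ)
open import Relation.Nullary using (¬_; yes; no; does; contradiction)
open import Relation.Nullary.Decidable using (⌊_⌋; dec-true; isYes≗does)
open import Relation.Binary.PropositionalEquality
open import Function using (_∘_)
open import Algebra.Properties.CommutativeMonoid.Sum +-0-commutativeMonoid
  using (sum-syntax; sum-cong-≗; sum-replicate-zero; sum-permute)
  renaming (sum to ∑)
open import Algebra.Properties.CommutativeSemigroup +-commutativeSemigroup
  using (xy∙z≈xz∙y)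

private
  variable
    N n m : ℕ

∑-split : ∀ n (h : Fin (n + m) → ℕ) →
          ∑ h ≡ ∑[ a < n ] h (a ↑ˡ m) + ∑[ c < m ] h (n ↑ʳ c)
∑-split zero    h = refl
∑-split (suc n) h = trans (cong (h zero +_) (∑-split n (h ∘ suc))) (sym (+-assoc (h zero) _ _))

sum-tabulate : (h : Fin N → ℕ) → sum (tabulate h) ≡ ∑ h
sum-tabulate {zero}  h = refl
sum-tabulate {suc N} h = cong (h zero +_) (sum-tabulate (h ∘ suc))

sum-map-allFin : (h : Fin N → ℕ) → sum (map h (allFin N)) ≡ ∑ h
sum-map-allFin h = trans (cong sum (map-tabulate (λ x → x) h)) (sum-tabulate h)

sum-concat-tabulate : (rows : Fin N → List ℕ) → sum (concat (tabulate rows)) ≡ ∑[ x < N ] sum (rows x)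
sum-concat-tabulate {zero}  rows = refl
sum-concat-tabulate {suc N} rows =
  trans (sum-++ (rows zero) _) (cong (sum (rows zero) +_) (sum-concat-tabulate (rows ∘ suc)))

ind : Bool → ℕ
ind b = if b then 1 else 0

δ : Fin N → Fin N → ℕ
δ x a = ind (does (x ≟ a))

⌊⌋-δ : (x a : Fin N) → ind ⌊ x ≟ a ⌋ ≡ δ x a
⌊⌋-δ x a = cong ind (isYes≗does (x ≟ a))

δ-refl : (a : Fin N) → δ a a ≡ 1
δ-refl a with a ≟ a
... | yes _   = refl
... | no a≢a = contradiction refl a≢a

δ-≢ : {x a : Fin N} → ¬ x ≡ a → δ x a ≡ 0
δ-≢ {x = x} {a} x≢a with x ≟ a
... | yes x≡a = contradiction x≡a x≢a
... | no _    = refl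

δ-cong-⇔ : {x a : Fin N} {y b : Fin m} → (x ≡ a → y ≡ b) → (y ≡ b → x ≡ a) → δ x a ≡ δ y b
δ-cong-⇔ {x = x} {a} {b = b} x≡a⇒y≡b y≡b⇒x≡a with x ≟ a
... | yes x≡a = sym (subst (λ y → δ y b ≡ 1) (sym (x≡a⇒y≡b x≡a)) (δ-refl b))
... | no x≢a  = sym (δ-≢ (x≢a ∘ y≡b⇒x≡a))

∑-δ : (a : Fin N) → ∑[ x < N ] δ x a ≡ 1
∑-δ {suc N} zero    = cong suc (sum-replicate-zero N)
∑-δ {suc N} (suc a) = ∑-δ a

δ-injective : (g : Fin N → Fin m) → (∀ {x y} → g x ≡ g y → x ≡ y) →
              ∀ x a → δ (g x) (g a) ≡ δ x a
δ-injective g g-inj x a = δ-cong-⇔ g-inj (cong g)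

δ-permute : (π : Permutation N N) (x a : Fin N) → δ (π ⟨$⟩ʳ x) a ≡ δ x (π ⟨$⟩ˡ a)
δ-permute π x a =
  δ-cong-⇔ (λ e → trans (sym (Perm.inverseˡ π)) (cong (π ⟨$⟩ˡ_) e))
           (λ e → trans (cong (π ⟨$⟩ʳ_) e) (Perm.inverseʳ π))

transpose-second : (i j : Fin N) → PC.transpose i j j ≡ i
transpose-second i j with j ≟ i
... | yes j≡i = j≡i
... | no _ rewrite dec-true (j ≟ j) refl = refl

transpose-respects : {A : Set} (f : Fin N → A) {i j : Fin N} →
                     f i ≡ f j → ∀ k → f (PC.transpose i j k) ≡ f k
transpose-respects f {i} {j} fi≡fj k with k ≟ i
... | yes refl = sym fi≡fj
... | no _ with k ≟ j
...   | yes refl = fi≡fj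
...   | no _     = refl

absDiffSum : (Fin N → ℕ) → ℕ
absDiffSum {N} f = ∑[ x < N ] ∑[ y < N ] ∣ f x - f y ∣

absDiffSum-cong : {f g : Fin N → ℕ} → (∀ x → f x ≡ g x) → absDiffSum f ≡ absDiffSum g
absDiffSum-cong f≗g = sum-cong-≗ (λ x → sum-cong-≗ (λ y → cong₂ ∣_-_∣ (f≗g x) (f≗g y)))

absDiffSum-permute : (f : Fin N → ℕ) (π : Permutation N N) →
                     absDiffSum (f ∘ (π ⟨$⟩ʳ_)) ≡ absDiffSum f
absDiffSum-permute f π =
  trans (sum-cong-≗ (λ x → sym (sum-permute (λ y → ∣ f (π ⟨$⟩ʳ x) - f y ∣) π)))
        (sym (sum-permute (λ x → ∑[ y < _ ] ∣ f x - f y ∣) π))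

deg-∑ : (a : Adj N) (x : Fin N) → deg a x ≡ ∑[ y < N ] ind (a x y)
deg-∑ a x = sum-map-allFin (λ y → ind (a x y))

irrt-absDiffSum : (a : Adj N) → irrt a ≡ absDiffSum (deg a) / 2
irrt-absDiffSum {N} a = cong (_/ 2) (begin
  sum (concat (map row (tabulate (λ x → x)))) ≡⟨ cong (sum ∘ concat) (map-tabulate (λ x → x) row) ⟩
  sum (concat (tabulate row))                  ≡⟨ sum-concat-tabulate row ⟩
  ∑[ x < N ] sum (row x)                       ≡⟨ sum-cong-≗ (λ x → sum-map-allFin (λ y → ∣ deg a x - deg a y ∣)) ⟩
  absDiffSum (deg a)                           ∎)
  where
  open ≡-Reasoning
  row : Fin N → List ℕ
  row x = map (λ y → ∣ deg a x - deg a y ∣) (allFin N)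

bump : (Fin N → ℕ) → Fin N → Fin N → ℕ
bump f a x = f x + δ x a

bump-comm : (f : Fin N → ℕ) (a b : Fin N) → ∀ x → bump (bump f a) b x ≡ bump (bump f b) a x
bump-comm f a b x = xy∙z≈xz∙y (f x) (δ x a) (δ x b)

bump-swap : (f : Fin N → ℕ) {a b : Fin N} → f a ≡ f b →
            absDiffSum (bump f a) ≡ absDiffSum (bump f b)
bump-swap f {a} {b} fa≡fb = begin
  absDiffSum (bump f a)                ≡⟨ absDiffSum-permute (bump f a) τ ⟨
  absDiffSum (bump f a ∘ (τ ⟨$⟩ʳ_))   ≡⟨ absDiffSum-cong transposed ⟩
  absDiffSum (bump f b)                ∎
  where
  open ≡-Reasoning
  τ = Perm.transpose a b
  transposed : ∀ x → bump f a (τ ⟨$⟩ʳ x) ≡ bump f b x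
  transposed x = cong₂ _+_ (transpose-respects f fa≡fb x)
                           (trans (δ-permute τ x a) (cong (δ x) (transpose-second b a)))

exchange-bumps : (f : Fin N → ℕ) {p q r s : Fin N} →
                 f p ≡ f s → f q ≡ f r → ¬ p ≡ q → ¬ r ≡ s →
                 absDiffSum (bump (bump f p) q) ≡ absDiffSum (bump (bump f r) s)
exchange-bumps f {p} {q} {r} {s} fp≡fs fq≡fr p≢q r≢s with q ≟ s
... | yes refl = begin
  absDiffSum (bump (bump f p) q) ≡⟨ absDiffSum-cong (bump-comm f p q) ⟩
  absDiffSum (bump (bump f q) p) ≡⟨ bump-swap (bump f q) (cong₂ _+_ (trans fp≡fs fq≡fr)
                                                             (trans (δ-≢ p≢q) (sym (δ-≢ r≢s)))) ⟩
  absDiffSum (bump (bump f q) r) ≡⟨ absDiffSum-cong (bump-comm f q r) ⟩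
  absDiffSum (bump (bump f r) q) ∎
  where open ≡-Reasoning
... | no q≢s = begin
  absDiffSum (bump (bump f p) q) ≡⟨ absDiffSum-cong (bump-comm f p q) ⟩
  absDiffSum (bump (bump f q) p) ≡⟨ bump-swap (bump f q) (cong₂ _+_ fp≡fs
                                                             (trans (δ-≢ p≢q) (sym (δ-≢ (q≢s ∘ sym))))) ⟩
  absDiffSum (bump (bump f q) s) ≡⟨ absDiffSum-cong (bump-comm f q s) ⟩
  absDiffSum (bump (bump f s) q) ≡⟨ bump-swap (bump f s) (cong₂ _+_ fq≡fr
                                                             (trans (δ-≢ q≢s) (sym (δ-≢ r≢s)))) ⟩
  absDiffSum (bump (bump f s) r) ≡⟨ absDiffSum-cong (bump-comm f s r) ⟩
  absDiffSum (bump (bump f r) s) ∎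
  where open ≡-Reasoning

blocks-ext : ∀ n {A : Set} {f g : Fin (n + m) → A} →
             (∀ a → f (a ↑ˡ m) ≡ g (a ↑ˡ m)) → (∀ c → f (n ↑ʳ c) ≡ g (n ↑ʳ c)) →
             ∀ x → f x ≡ g x
blocks-ext zero    left right x       = right x
blocks-ext (suc n) left right zero    = left zero
blocks-ext (suc n) {f = f} {g} left right (suc x) =
  blocks-ext n {f = f ∘ suc} {g ∘ suc} (left ∘ suc) right x

↑ˡ≢↑ʳ : (a : Fin n) (c : Fin m) → ¬ a ↑ˡ m ≡ n ↑ʳ c
↑ˡ≢↑ʳ zero    c ()
↑ˡ≢↑ʳ (suc a) c e = ↑ˡ≢↑ʳ a c (suc-injective e)

jointDegrees : Graph n → Graph m → Fin (n + m) → ℕ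
jointDegrees G H = deg (adj G) ++ deg (adj H)

jointDegrees-G : (G : Graph n) (H : Graph m) (a : Fin n) → jointDegrees G H (a ↑ˡ m) ≡ deg (adj G) a
jointDegrees-G G H = lookup-++ˡ (deg (adj G)) (deg (adj H))

jointDegrees-H : (G : Graph n) (H : Graph m) (c : Fin m) → jointDegrees G H (n ↑ʳ c) ≡ deg (adj H) c
jointDegrees-H G H = lookup-++ʳ (deg (adj G)) (deg (adj H))

module EdgeJoint (G : Graph n) (H : Graph m) (u : Fin n) (v : Fin m) where

  E : Adj (n + m)
  E = edgeJoint G H u v

  adj-GG : ∀ a b → E (a ↑ˡ m) (b ↑ˡ m) ≡ adj G a b
  adj-GG a b rewrite splitAt-↑ˡ n a m | splitAt-↑ˡ n b m = refl

  adj-GH : ∀ a c → E (a ↑ˡ m) (n ↑ʳ c) ≡ (⌊ a ≟ u ⌋ ∧ ⌊ c ≟ v ⌋)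
  adj-GH a c rewrite splitAt-↑ˡ n a m | splitAt-↑ʳ n m c = refl

  adj-HG : ∀ c b → E (n ↑ʳ c) (b ↑ˡ m) ≡ (⌊ b ≟ u ⌋ ∧ ⌊ c ≟ v ⌋)
  adj-HG c b rewrite splitAt-↑ʳ n m c | splitAt-↑ˡ n b m = refl

  adj-HH : ∀ c d → E (n ↑ʳ c) (n ↑ʳ d) ≡ adj H c d
  adj-HH c d rewrite splitAt-↑ʳ n m c | splitAt-↑ʳ n m d = refl

  -- The new edge contributes one neighbour on the other side exactly at its endpoint.
  ∑-edge : ∀ {k} (B : Bool) (w : Fin k) → ∑[ y < k ] ind (B ∧ ⌊ y ≟ w ⌋) ≡ ind B
  ∑-edge true  w = trans (sum-cong-≗ (λ y → ⌊⌋-δ y w)) (∑-δ w)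
  ∑-edge {k} false w = sum-replicate-zero k

  deg-G : ∀ a → deg E (a ↑ˡ m) ≡ deg (adj G) a + δ a u
  deg-G a = begin
    deg E (a ↑ˡ m)                                                  ≡⟨ deg-∑ E (a ↑ˡ m) ⟩
    ∑[ y < n + m ] ind (E (a ↑ˡ m) y)                               ≡⟨ ∑-split n _ ⟩
    ∑[ b < n ] ind (E (a ↑ˡ m) (b ↑ˡ m)) + ∑[ c < m ] ind (E (a ↑ˡ m) (n ↑ʳ c))
      ≡⟨ cong₂ _+_ (sum-cong-≗ (cong ind ∘ adj-GG a)) (sum-cong-≗ (cong ind ∘ adj-GH a)) ⟩
    ∑[ b < n ] ind (adj G a b) + ∑[ c < m ] ind (⌊ a ≟ u ⌋ ∧ ⌊ c ≟ v ⌋)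
      ≡⟨ cong₂ _+_ (sym (deg-∑ (adj G) a)) (trans (∑-edge (⌊ a ≟ u ⌋) v) (⌊⌋-δ a u)) ⟩
    deg (adj G) a + δ a u                                           ∎
    where open ≡-Reasoning

  deg-H : ∀ c → deg E (n ↑ʳ c) ≡ deg (adj H) c + δ c v
  deg-H c = begin
    deg E (n ↑ʳ c)                                                  ≡⟨ deg-∑ E (n ↑ʳ c) ⟩
    ∑[ y < n + m ] ind (E (n ↑ʳ c) y)                               ≡⟨ ∑-split n _ ⟩
    ∑[ b < n ] ind (E (n ↑ʳ c) (b ↑ˡ m)) + ∑[ d < m ] ind (E (n ↑ʳ c) (n ↑ʳ d))
      ≡⟨ cong₂ _+_ (sum-cong-≗ (λ b → cong ind (trans (adj-HG c b) (∧-comm ⌊ b ≟ u ⌋ ⌊ c ≟ v ⌋))))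
                   (sum-cong-≗ (cong ind ∘ adj-HH c)) ⟩
    ∑[ b < n ] ind (⌊ c ≟ v ⌋ ∧ ⌊ b ≟ u ⌋) + ∑[ d < m ] ind (adj H c d)
      ≡⟨ cong₂ _+_ (trans (∑-edge (⌊ c ≟ v ⌋) u) (⌊⌋-δ c v)) (sym (deg-∑ (adj H) c)) ⟩
    δ c v + deg (adj H) c                                           ≡⟨ xy∙z≈xz∙y 0 (δ c v) _ ⟩
    deg (adj H) c + δ c v                                           ∎
    where open ≡-Reasoning

  deg-edgeJoint : ∀ x → deg E x ≡ bump (bump (jointDegrees G H) (u ↑ˡ m)) (n ↑ʳ v) x
  deg-edgeJoint = blocks-ext n on-G on-H
    where
    open ≡-Reasoning
    on-G : ∀ a → deg E (a ↑ˡ m) ≡ bump (bump (jointDegrees G H) (u ↑ˡ m)) (n ↑ʳ v) (a ↑ˡ m)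
    on-G a = begin
      deg E (a ↑ˡ m)             ≡⟨ deg-G a ⟩
      deg (adj G) a + δ a u      ≡⟨ +-identityʳ _ ⟨
      deg (adj G) a + δ a u + 0
        ≡⟨ cong₂ _+_ (cong₂ _+_ (jointDegrees-G G H a)
                                (δ-injective (_↑ˡ m) (↑ˡ-injective m _ _) a u))
                     (δ-≢ (↑ˡ≢↑ʳ a v)) ⟨
      jointDegrees G H (a ↑ˡ m) + δ (a ↑ˡ m) (u ↑ˡ m) + δ (a ↑ˡ m) (n ↑ʳ v) ∎
    on-H : ∀ c → deg E (n ↑ʳ c) ≡ bump (bump (jointDegrees G H) (u ↑ˡ m)) (n ↑ʳ v) (n ↑ʳ c)
    on-H c = begin
      deg E (n ↑ʳ c)             ≡⟨ deg-H c ⟩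
      deg (adj H) c + δ c v      ≡⟨ cong (_+ δ c v) (+-identityʳ _) ⟨
      deg (adj H) c + 0 + δ c v
        ≡⟨ cong₂ _+_ (cong₂ _+_ (jointDegrees-H G H c)
                                (δ-≢ (↑ˡ≢↑ʳ u c ∘ sym)))
                     (δ-injective (n ↑ʳ_) (↑ʳ-injective n _ _) c v) ⟨
      jointDegrees G H (n ↑ʳ c) + δ (n ↑ʳ c) (u ↑ˡ m) + δ (n ↑ʳ c) (n ↑ʳ v) ∎

  irrt-edgeJoint : irrt E ≡ absDiffSum (bump (bump (jointDegrees G H) (u ↑ˡ m)) (n ↑ʳ v)) / 2
  irrt-edgeJoint = trans (irrt-absDiffSum E) (cong (_/ 2) (absDiffSum-cong deg-edgeJoint))

corollary2p6 : ∀ {n m} (G₁ : Graph n) (G₂ : Graph m) →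
    Connected G₁ → Connected G₂ →
    DegSorted G₁ → DegSorted G₂ →
    (i k : Fin n) (j l : Fin m) →
    deg (adj G₁) i ≡ deg (adj G₂) j →
    deg (adj G₁) k ≡ deg (adj G₂) l →
    irrt (edgeJoint G₁ G₂ i l) ≡ irrt (edgeJoint G₁ G₂ k j)
corollary2p6 {n} {m} G₁ G₂ _ _ _ _ i k j l dᵢ≡dⱼ dₖ≡dₗ = begin
  irrt (edgeJoint G₁ G₂ i l)                               ≡⟨ irrt-edgeJoint i l ⟩
  absDiffSum (bump (bump d (i ↑ˡ m)) (n ↑ʳ l)) / 2
    ≡⟨ cong (_/ 2) (exchange-bumps d d-uᵢ≡d-vⱼ d-vₗ≡d-uₖ (↑ˡ≢↑ʳ i l) (↑ˡ≢↑ʳ k j)) ⟩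
  absDiffSum (bump (bump d (k ↑ˡ m)) (n ↑ʳ j)) / 2         ≡⟨ irrt-edgeJoint k j ⟨
  irrt (edgeJoint G₁ G₂ k j)                               ∎
  where
  open ≡-Reasoning
  open EdgeJoint G₁ G₂ using (irrt-edgeJoint)
  d : Fin (n + m) → ℕ
  d = jointDegrees G₁ G₂
  d-uᵢ≡d-vⱼ : d (i ↑ˡ m) ≡ d (n ↑ʳ j)
  d-uᵢ≡d-vⱼ = trans (jointDegrees-G G₁ G₂ i) (trans dᵢ≡dⱼ (sym (jointDegrees-H G₁ G₂ j)))
  d-vₗ≡d-uₖ : d (n ↑ʳ l) ≡ d (k ↑ˡ m)
  d-vₗ≡d-uₖ = trans (jointDegrees-H G₁ G₂ l) (trans (sym dₖ≡dₗ) (sym (jointDegrees-G G₁ G₂ k)))
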